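{- For every term $\mathbf{t}$, scalar $\alpha$, type $T$ and context $\Gamma$: if $\Gamma\vdash\alpha.\mathbf{t}:T$, then there exist a unit type $U$ and a scalar $\gamma$ such that $T\equiv\alpha.(\gamma.U)$.
   Context: Lineal terms over a commutative ring $(\mathcal{S},+,\times)$: basis terms $\mathbf{b}::=x\mid\lambda x\,\mathbf{t}$, terms $\mathbf{t}::=\mathbf{b}\mid(\mathbf{t})~\mathbf{r}\mid\mathbf{0}\mid\alpha.\mathbf{t}\mid\mathbf{t}+\mathbf{r}$, modulo AC of $+$. Scalar type system: types $T::=U\mid\forall X.T\mid\alpha.T\mid\overline{0}$, unit types $U::=X\mid U\to T\mid\forall X.U$, substitution of type variables only by unit types; $\equiv$ is the least congruence with $\alpha.\overline{0}\equiv\overline{0}$, $0.T\equiv\overline{0}$, $1.T\equiv T$, $\alpha.(\beta.T)\equiv(\alpha\times\beta).T$, $\forall X.\alpha.T\equiv\alpha.\forall X.T$. Contexts: finite sets of $x:U$ ($U$ unit). Rules: $\Gamma,x:U\vdash x:U$; from $\Gamma\vdash\mathbf{t}:T$, $T\equiv S$ infer $\Gamma\vdash\mathbf{t}:S$; from $\Gamma\vdash\mathbf{t}:\alpha.(U\to T)$, $\Gamma\vdash\mathbf{r}:\beta.U$ infer $\Gamma\vdash(\mathbf{t})~\mathbf{r}:(\alpha\times\beta).T$; from $\Gamma,x:U\vdash\mathbf{t}:T$ infer $\Gamma\vdash\lambda x\,\mathbf{t}:U\to T$; from $\Gamma\vdash\mathbf{t}:\forall X.T$ infer $\Gamma\vdash\mathbf{t}:T[U/X]$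 ($U$ unit); from $\Gamma\vdash\mathbf{t}:T$ infer $\Gamma\vdash\mathbf{t}:\forall X.T$ if $X$ not free in $\Gamma$; $\Gamma\vdash\mathbf{0}:\overline{0}$; from $\Gamma\vdash\mathbf{t}:\alpha.T$, $\Gamma\vdash\mathbf{r}:\beta.T$ infer $\Gamma\vdash\mathbf{t}+\mathbf{r}:(\alpha+\beta).T$; from $\Gamma\vdash\mathbf{t}:T$ infer $\Gamma\vdash\alpha.\mathbf{t}:\alpha.T$. -}

module Defs where

open import Level using (Level; _⊔_)
open import Algebra.Bundles using (CommutativeRing)
open import Data.Nat as ℕ using (ℕ; zero; suc; _<ᵇ_; _≡ᵇ_; pred)
open import Data.Bool using (if_then_else_)
open import Data.List using (List; []; _∷_; map)
open import Data.Product using (_×_; _,_)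
open import Relation.Binary.PropositionalEquality using (_≢_)

module Lineal {c ℓ : Level} (R : CommutativeRing c ℓ) where

  open CommutativeRing R
    renaming (Carrier to S; _+_ to _+ₛ_; _*_ to _×ₛ_; _≈_ to _≈ₛ_)
    using (0#; 1#)

  -- Terms (term variables are named by natural numbers)
  -- t ::= x | λx t | (t) r | 0 | α.t | t + r
  infixl 7 _$_
  infixr 6 _⊙_
  infixl 5 _⊕_
  data Term : Set c where
    `_  : ℕ → Term
    ƛ   : ℕ → Term → Term
    _$_ : Term → Term → Term
    𝟎   : Term
    _⊙_ : S → Term → Term
    _⊕_ : Term → Term → Term

  -- Types (type variables are de Bruijn indices)
  -- U ::= X | U → T | ∀X.U        T ::= U | ∀X.T | α.T | 0̄
  infixr 4 _⇒_
  infixr 6 _•_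
  mutual
    data Unit : Set c where
      tvar : ℕ → Unit
      _⇒_  : Unit → Type → Unit
      ∀U   : Unit → Unit

    data Type : Set c where
      ⌜_⌝ : Unit → Type
      ∀T  : Type → Type
      _•_ : S → Type → Type
      𝟘   : Type

  mutual
    shiftU : ℕ → Unit → Unit
    shiftU k (tvar n) = if n <ᵇ k then tvar n else tvar (suc n)
    shiftU k (U ⇒ T)  = shiftU k U ⇒ shiftT k T
    shiftU k (∀U U)   = ∀U (shiftU (suc k) U)

    shiftT : ℕ → Type → Type
    shiftT k ⌜ U ⌝   = ⌜ shiftU k U ⌝
    shiftT k (∀T T)  = ∀T (shiftT (suc k) T)
    shiftT k (α • T) = α • shiftT k T
    shiftT k 𝟘       = 𝟘

  mutual
    substU : Unit → ℕ → Unit → Unit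
    substU (tvar n) j V =
      if n ≡ᵇ j then V else (if j <ᵇ n then tvar (pred n) else tvar n)
    substU (U ⇒ T) j V = substU U j V ⇒ substT T j V
    substU (∀U U)  j V = ∀U (substU U (suc j) (shiftU 0 V))

    substT : Type → ℕ → Unit → Type
    substT ⌜ U ⌝   j V = ⌜ substU U j V ⌝
    substT (∀T T)  j V = ∀T (substT T (suc j) (shiftU 0 V))
    substT (α • T) j V = α • substT T j V
    substT 𝟘       j V = 𝟘

  -- T[U/X] where X is the bound variable of ∀X.T
  _[_] : Type → Unit → Type
  T [ U ] = substT T 0 U

  infix 3 _≡ᵀ_
  data _≡ᵀ_ : Type → Type → Set (c ⊔ ℓ) where
    ≡-refl  : ∀ {T} → T ≡ᵀ T
    ≡-sym   : ∀ {T S} → T ≡ᵀ S → S ≡ᵀ T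
    ≡-trans : ∀ {T S Q} → T ≡ᵀ S → S ≡ᵀ Q → T ≡ᵀ Q
    ≡-⇒     : ∀ {U U' T T'} → ⌜ U ⌝ ≡ᵀ ⌜ U' ⌝ → T ≡ᵀ T' → ⌜ U ⇒ T ⌝ ≡ᵀ ⌜ U' ⇒ T' ⌝
    ≡-∀U    : ∀ {U U'} → ⌜ U ⌝ ≡ᵀ ⌜ U' ⌝ → ⌜ ∀U U ⌝ ≡ᵀ ⌜ ∀U U' ⌝
    ≡-∀T    : ∀ {T T'} → T ≡ᵀ T' → ∀T T ≡ᵀ ∀T T'
    ≡-•     : ∀ {α β T T'} → α ≈ₛ β → T ≡ᵀ T' → α • T ≡ᵀ β • T'
    -- the unit type ∀X.U and the type ∀X.U are the same type
    ≡-∀unit : ∀ {U} → ⌜ ∀U U ⌝ ≡ᵀ ∀T ⌜ U ⌝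
    ≡-α0    : ∀ {α} → α • 𝟘 ≡ᵀ 𝟘
    ≡-0T    : ∀ {T} → 0# • T ≡ᵀ 𝟘
    ≡-1T    : ∀ {T} → 1# • T ≡ᵀ T
    ≡-αβ    : ∀ {α β T} → α • (β • T) ≡ᵀ (α ×ₛ β) • T
    ≡-∀α    : ∀ {α T} → ∀T (α • T) ≡ᵀ α • ∀T T

  -- Contexts: lists of bindings x : U (the most recent binding wins)
  Context : Set c
  Context = List (ℕ × Unit)

  infix 4 _∋_∶_
  data _∋_∶_ : Context → ℕ → Unit → Set c where
    here  : ∀ {Γ x U} → ((x , U) ∷ Γ) ∋ x ∶ U
    there : ∀ {Γ x y U V} → x ≢ y → Γ ∋ x ∶ U → ((y , V) ∷ Γ) ∋ x ∶ U

  shiftΓ : Context → Context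
  shiftΓ = map (λ { (x , U) → (x , shiftU 0 U) })

  infix 2 _⊢_∶_
  data _⊢_∶_ : Context → Term → Type → Set (c ⊔ ℓ) where
    ax    : ∀ {Γ x U} → Γ ∋ x ∶ U → Γ ⊢ ` x ∶ ⌜ U ⌝
    equiv : ∀ {Γ t T S} → Γ ⊢ t ∶ T → T ≡ᵀ S → Γ ⊢ t ∶ S
    →E    : ∀ {Γ t r α β U T} →
            Γ ⊢ t ∶ α • ⌜ U ⇒ T ⌝ → Γ ⊢ r ∶ β • ⌜ U ⌝ →
            Γ ⊢ t $ r ∶ (α ×ₛ β) • T
    →I    : ∀ {Γ x t U T} → ((x , U) ∷ Γ) ⊢ t ∶ T → Γ ⊢ ƛ x t ∶ ⌜ U ⇒ T ⌝
    ∀E    : ∀ {Γ t T} (U : Unit) → Γ ⊢ t ∶ ∀T T → Γ ⊢ t ∶ T [ U ]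
    ∀I    : ∀ {Γ t T} → shiftΓ Γ ⊢ t ∶ T → Γ ⊢ t ∶ ∀T T
    ax0   : ∀ {Γ} → Γ ⊢ 𝟎 ∶ 𝟘
    +I    : ∀ {Γ t r α β T} → Γ ⊢ t ∶ α • T → Γ ⊢ r ∶ β • T →
            Γ ⊢ t ⊕ r ∶ (α +ₛ β) • T
    αI    : ∀ {Γ t α T} → Γ ⊢ t ∶ T → Γ ⊢ α ⊙ t ∶ α • T

-- Every type has a scalar: the product of its scalar prefixes (0 for 0̄).
-- It is preserved by the equivalence ≡ᵀ and by type substitution, and a type
-- is always equivalent to its scalar times a unit type.  Among the typing
-- rules, only αI, equiv, ∀E and ∀I can conclude a judgement about α.t; αI
-- makes α a left factor of the scalar and the other three keep it, so the
-- scalar of T is α × γ and T ≡ᵀ (α × γ).U ≡ᵀ α.(γ.U).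
module Submission where

open import Defs
open import Level using (Level)
open import Algebra.Bundles using (CommutativeRing)
open import Data.Nat using (suc)
open import Data.Product using (Σ; _,_)
open import Relation.Binary.PropositionalEquality as ≡ using (_≡_)

module ScalarTypes {c ℓ : Level} (R : CommutativeRing c ℓ) where
  open Lineal R
  open CommutativeRing R
    renaming (Carrier to S; _*_ to _×ₛ_; _≈_ to _≈ₛ_)
  open import Algebra.Definitions.RawMagma *-rawMagma using (_∣ˡ_)
  open import Algebra.Properties.Magma.Divisibility *-magma
    using (x∣ˡxy; ∣ˡ-respʳ-≈)

  scalar : Type → S
  scalar ⌜ U ⌝   = 1#
  scalar (∀T T)  = scalar T
  scalar (α • T) = α ×ₛ scalar T
  scalar 𝟘       = 0#

  unitPart : Type → Unit
  unitPart ⌜ U ⌝   = U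
  unitPart (∀T T)  = ∀U (unitPart T)
  unitPart (α • T) = unitPart T
  unitPart 𝟘       = tvar 0

  scalar-substT : ∀ T j V → scalar (substT T j V) ≡ scalar T
  scalar-substT ⌜ U ⌝   j V = ≡.refl
  scalar-substT (∀T T)  j V = scalar-substT T (suc j) (shiftU 0 V)
  scalar-substT (α • T) j V = ≡.cong (α ×ₛ_) (scalar-substT T j V)
  scalar-substT 𝟘       j V = ≡.refl

  scalar-resp-≡ᵀ : ∀ {T T′} → T ≡ᵀ T′ → scalar T ≈ₛ scalar T′
  scalar-resp-≡ᵀ ≡-refl        = refl
  scalar-resp-≡ᵀ (≡-sym e)     = sym (scalar-resp-≡ᵀ e)
  scalar-resp-≡ᵀ (≡-trans e f) = trans (scalar-resp-≡ᵀ e) (scalar-resp-≡ᵀ f)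
  scalar-resp-≡ᵀ (≡-⇒ _ _)     = refl
  scalar-resp-≡ᵀ (≡-∀U _)      = refl
  scalar-resp-≡ᵀ (≡-∀T e)      = scalar-resp-≡ᵀ e
  scalar-resp-≡ᵀ (≡-• α≈β e)   = *-cong α≈β (scalar-resp-≡ᵀ e)
  scalar-resp-≡ᵀ ≡-∀unit       = refl
  scalar-resp-≡ᵀ ≡-α0          = zeroʳ _
  scalar-resp-≡ᵀ ≡-0T          = zeroˡ _
  scalar-resp-≡ᵀ ≡-1T          = *-identityˡ _
  scalar-resp-≡ᵀ ≡-αβ          = sym (*-assoc _ _ _)
  scalar-resp-≡ᵀ ≡-∀α          = refl

  ≡ᵀ-scalar•unitPart : ∀ T → T ≡ᵀ scalar T • ⌜ unitPart T ⌝
  ≡ᵀ-scalar•unitPart ⌜ U ⌝   = ≡-sym ≡-1T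
  ≡ᵀ-scalar•unitPart (∀T T)  =
    ≡-trans (≡-∀T (≡ᵀ-scalar•unitPart T))
            (≡-trans ≡-∀α (≡-• refl (≡-sym ≡-∀unit)))
  ≡ᵀ-scalar•unitPart (α • T) =
    ≡-trans (≡-• refl (≡ᵀ-scalar•unitPart T)) ≡-αβ
  ≡ᵀ-scalar•unitPart 𝟘       = ≡-sym ≡-0T

  ⊙-typing⇒∣ˡscalar : ∀ {Γ t α T} → Γ ⊢ α ⊙ t ∶ T → α ∣ˡ scalar T
  ⊙-typing⇒∣ˡscalar (equiv ⊢t e) =
    ∣ˡ-respʳ-≈ (scalar-resp-≡ᵀ e) (⊙-typing⇒∣ˡscalar ⊢t)
  ⊙-typing⇒∣ˡscalar (∀E {T = T} U ⊢t) rewrite scalar-substT T 0 U =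
    ⊙-typing⇒∣ˡscalar ⊢t
  ⊙-typing⇒∣ˡscalar (∀I ⊢t) = ⊙-typing⇒∣ˡscalar ⊢t
  ⊙-typing⇒∣ˡscalar (αI {α = α} {T = T} _) = x∣ˡxy α (scalar T)

  ∣ˡscalar⇒≡ᵀ-α•γ•unit : ∀ α T → α ∣ˡ scalar T →
    Σ Unit (λ U → Σ S (λ γ → T ≡ᵀ α • (γ • ⌜ U ⌝)))
  ∣ˡscalar⇒≡ᵀ-α•γ•unit α T record { quotient = γ ; equality = αγ≈scalar } =
    unitPart T , γ ,
    ≡-trans (≡ᵀ-scalar•unitPart T)
            (≡-trans (≡-• (sym αγ≈scalar) ≡-refl) (≡-sym ≡-αβ))

mainTheorem14 : {c ℓ : Level} (R : CommutativeRing c ℓ) →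
    let open Lineal R in
    (t : Term) (α : CommutativeRing.Carrier R) (T : Type) (Γ : Context) →
    Γ ⊢ α ⊙ t ∶ T →
    Σ Unit (λ U → Σ (CommutativeRing.Carrier R) (λ γ → T ≡ᵀ α • (γ • ⌜ U ⌝)))
mainTheorem14 R t α T Γ ⊢α⊙t =
  ∣ˡscalar⇒≡ᵀ-α•γ•unit α T (⊙-typing⇒∣ˡscalar ⊢α⊙t)
  where open ScalarTypes R
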